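{- The following are equivalent: (i) (Union-closed sets conjecture) For every finite collection $S$ of finite sets with $|S|>1$ such that $A\cup B\in S$ for all $A,B\in S$, there is an element contained in at least half of the members of $S$. (ii) For every integer $n>1$, the symmetric multiaction $\Gamma^{\mathrm{sym}}(\mathbb{F}_2^n)$ is a monoidal network on the ring $\mathbb{F}_2^n$.
   Context: All rings are commutative with identity. For a ring $R$, $\mathrm{Aut}(R)$ is its group of ring automorphisms and $R^{\mathrm{Aut}(R)}$ the subring of elements fixed by every automorphism. A group action of $G$ on a set $X$ means a homomorphism $G\to\mathrm{Sym}(X)$ (no compatibility with ring structure required); for $S\subseteq X$, $G^S$ denotes the setwise stabilizer of $S$. An action $(H,\phi)$ on $X$ extends $(G,\gamma)$ if $\mathrm{im}\,\gamma\subseteq\mathrm{im}\,\phi$. A multiaction on $R$ is a family $\{(\Gamma_I,\gamma_I)\}$ indexed by the ideals $I$ of $R$, where $(\Gamma_I,\gamma_I)$ is an action of a group $\Gamma_I$ on the set $R/I$ extending the natural action of $\mathrm{Aut}(R/I)$; $\Gamma_0$ (zero ideal, acting on $R$) is the top action group. The symmetric multiaction $\Gamma^{\mathrm{sym}}(R)$ has $\Gamma_I=\mathrm{Sym}(R/I)$ with the natural action. An extended submonoid of $R$ is a multiplicatively closed subset $M\subseteq R$ with $1\in M$ and $R^{\mathrm{Aut}(R)}\subseteq M$. Given a multiaction, an extended submonoid $M$ and an ideal $I$ with projection $\pi:R\to R/I$, $I$ is a covering ideal of $M$ if there is an extended submonoid $\hat M\subseteq M$ with $M\setminus\hat M\subseteq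 I$ such that for every $g\in\Gamma_I^{\pi(\hat M)}$ there is $\tilde g\in\Gamma_0^{\hat M}$ with $\pi(\tilde g\cdot x)=g\cdot\pi(x)$ for all $x\in\hat M$. A multiaction is a monoidal network if every extended submonoid of $R$ has a covering ideal that is proper and nonzero. -}

module Defs where

open import Level using (0ℓ)
open import Data.Bool using (Bool; true; false; _xor_; _∧_)
open import Data.Nat using (ℕ; zero; suc; _≤_; _<_; _*_)
open import Data.Fin using (Fin)
open import Data.Fin.Subset using (Subset; _∪_)
open import Data.Fin.Subset.Properties using (_∈?_)
open import Data.Vec using (Vec; []; _∷_; zipWith; replicate)
open import Data.List using (List; length; filter)
open import Data.List.Membership.Propositional using (_∈_)
open import Data.List.Relation.Unary.Unique.Propositional using (Unique)
open import Data.Product using (Σ; ∃; _×_; _,_)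
open import Relation.Nullary using (¬_)
open import Relation.Binary.PropositionalEquality
  using (_≡_; _≢_; refl; sym; trans; cong; cong₂; subst)
open import Relation.Binary.Bundles using (Setoid)
open import Relation.Binary.Structures using (IsEquivalence)
open import Function.Bundles using (Inverse; _↔_)

-- A finite collection of finite sets is modelled (w.l.o.g., after
-- relabelling the finite union of its members) as a duplicate-free list
-- of subsets of Fin m, for some m.

UnionClosed : ∀ {m} → List (Subset m) → Set
UnionClosed S = ∀ {A B} → A ∈ S → B ∈ S → (A ∪ B) ∈ S

count∋ : ∀ {m} → Fin m → List (Subset m) → ℕ
count∋ i S = length (filter (λ A → i ∈? A) S)

UnionClosedConjecture : Set
UnionClosedConjecture =
  ∀ (m : ℕ) (S : List (Subset m)) →
    Unique S → 1 < length S → UnionClosed S →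
    ∃ λ (i : Fin m) → length S ≤ 2 * count∋ i S

R : ℕ → Set
R n = Vec Bool n

module _ {n : ℕ} where

  infixl 6 _+ᴿ_ _-ᴿ_
  infixl 7 _*ᴿ_

  _+ᴿ_ : R n → R n → R n
  _+ᴿ_ = zipWith _xor_

  _*ᴿ_ : R n → R n → R n
  _*ᴿ_ = zipWith _∧_

  0ᴿ : R n
  0ᴿ = replicate n false

  1ᴿ : R n
  1ᴿ = replicate n true

  -ᴿ_ : R n → R n
  -ᴿ x = x

  _-ᴿ_ : R n → R n → R n
  x -ᴿ y = x +ᴿ (-ᴿ y)

SubsetR : ℕ → Set
SubsetR n = R n → Bool

_∈ᴿ_ : ∀ {n} → R n → SubsetR n → Set
x ∈ᴿ S = S x ≡ true

record IsIdeal {n : ℕ} (I : SubsetR n) : Set where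
  field
    zero∈ : 0ᴿ ∈ᴿ I
    +-closed : ∀ {x y} → x ∈ᴿ I → y ∈ᴿ I → (x +ᴿ y) ∈ᴿ I
    neg-closed : ∀ {x} → x ∈ᴿ I → (-ᴿ x) ∈ᴿ I
    *-closed : ∀ r {x} → x ∈ᴿ I → (r *ᴿ x) ∈ᴿ I

Ideal : ℕ → Set
Ideal n = Σ (SubsetR n) IsIdeal

record Automorphism (n : ℕ) : Set where
  field
    bij : R n ↔ R n
  open Inverse bij public using (to)
  field
    hom-+ : ∀ x y → to (x +ᴿ y) ≡ to x +ᴿ to y
    hom-* : ∀ x y → to (x *ᴿ y) ≡ to x *ᴿ to y
    hom-1 : to 1ᴿ ≡ 1ᴿ

FixedByAut : ∀ {n} → R n → Set
FixedByAut {n} x = (σ : Automorphism n) → Automorphism.to σ x ≡ x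

record IsExtendedSubmonoid {n : ℕ} (M : SubsetR n) : Set where
  field
    one∈ : 1ᴿ ∈ᴿ M
    *-closed : ∀ {x y} → x ∈ᴿ M → y ∈ᴿ M → (x *ᴿ y) ∈ᴿ M
    fixed⊆ : ∀ {x} → FixedByAut x → x ∈ᴿ M

private
  xor-self : ∀ a → a xor a ≡ false
  xor-self true = refl
  xor-self false = refl

  xor-comm : ∀ a b → a xor b ≡ b xor a
  xor-comm true true = refl
  xor-comm true false = refl
  xor-comm false true = refl
  xor-comm false false = refl

  xor-tr : ∀ a b c → (a xor b) xor (b xor c) ≡ a xor c
  xor-tr true true true = refl
  xor-tr true true false = refl
  xor-tr true false true = refl
  xor-tr true false false = refl
  xor-tr false true true = refl
  xor-tr false true false = refl
  xor-tr false false true = refl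
  xor-tr false false false = refl

  +-self : ∀ {n} (x : R n) → x +ᴿ x ≡ 0ᴿ
  +-self [] = refl
  +-self (a ∷ x) = cong₂ _∷_ (xor-self a) (+-self x)

  +-comm : ∀ {n} (x y : R n) → x +ᴿ y ≡ y +ᴿ x
  +-comm [] [] = refl
  +-comm (a ∷ x) (b ∷ y) = cong₂ _∷_ (xor-comm a b) (+-comm x y)

  +-tr : ∀ {n} (x y z : R n) → (x +ᴿ y) +ᴿ (y +ᴿ z) ≡ x +ᴿ z
  +-tr [] [] [] = refl
  +-tr (a ∷ x) (b ∷ y) (c ∷ z) = cong₂ _∷_ (xor-tr a b c) (+-tr x y z)

module _ {n : ℕ} (I : Ideal n) where
  private
    P = Data.Product.proj₁ I
    open IsIdeal (Data.Product.proj₂ I)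

  _~_ : R n → R n → Set
  x ~ y = (x -ᴿ y) ∈ᴿ P

  ~-isEquivalence : IsEquivalence _~_
  ~-isEquivalence = record
    { refl = λ {x} → subst (λ z → z ∈ᴿ P) (sym (+-self x)) zero∈
    ; sym = λ {x} {y} p → subst (λ z → z ∈ᴿ P) (+-comm x y) (neg-closed p)
    ; trans = λ {x} {y} {z} p q → subst (λ w → w ∈ᴿ P) (+-tr x y z) (+-closed p q)
    }

  Quotient : Setoid 0ℓ 0ℓ
  Quotient = record { Carrier = R n ; _≈_ = _~_ ; isEquivalence = ~-isEquivalence }

  SymQ : Set
  SymQ = Inverse Quotient Quotient

SymR : ℕ → Set
SymR n = R n ↔ R n

-- Covering ideals and monoidal networks for the symmetric multiaction
-- Γ^sym(F₂ⁿ): Γ_I = Sym(R/I), Γ₀ = Sym(R), acting naturally.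

module _ {n : ℕ} where

  StabilizesQ : (I : Ideal n) → SymQ I → SubsetR n → Set
  StabilizesQ I g S =
    (∀ x → x ∈ᴿ S → ∃ λ y → y ∈ᴿ S × _~_ I (Inverse.to g x) y) ×
    (∀ y → y ∈ᴿ S → ∃ λ x → x ∈ᴿ S × _~_ I (Inverse.to g x) y)

  StabilizesR : SymR n → SubsetR n → Set
  StabilizesR g S =
    (∀ x → x ∈ᴿ S → Inverse.to g x ∈ᴿ S) ×
    (∀ y → y ∈ᴿ S → ∃ λ x → x ∈ᴿ S × Inverse.to g x ≡ y)

  IsCoveringIdeal : SubsetR n → Ideal n → Set
  IsCoveringIdeal M I =
    ∃ λ (M̂ : SubsetR n) →
      IsExtendedSubmonoid M̂ ×
      (∀ x → x ∈ᴿ M̂ → x ∈ᴿ M) ×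
      (∀ x → x ∈ᴿ M → ¬ (x ∈ᴿ M̂) → x ∈ᴿ Data.Product.proj₁ I) ×
      ((g : SymQ I) → StabilizesQ I g M̂ →
        ∃ λ (g̃ : SymR n) → StabilizesR g̃ M̂ ×
          (∀ x → x ∈ᴿ M̂ → _~_ I (Inverse.to g̃ x) (Inverse.to g x)))

  ProperIdeal : Ideal n → Set
  ProperIdeal I = ∃ λ x → Data.Product.proj₁ I x ≡ false

  NonzeroIdeal : Ideal n → Set
  NonzeroIdeal I = ∃ λ x → x ∈ᴿ Data.Product.proj₁ I × x ≢ 0ᴿ

SymIsMonoidalNetwork : ℕ → Set
SymIsMonoidalNetwork n =
  (M : SubsetR n) → IsExtendedSubmonoid M →
  ∃ λ (I : Ideal n) → ProperIdeal I × NonzeroIdeal I × IsCoveringIdeal M I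

-- Both sides are compared with a monoidal form of the conjecture
-- (`MonoidalConjecture K`): every extended submonoid M of F₂ᴷ has a
-- coordinate vanishing on at least half of its members.  Since the
-- elements of F₂ᴷ fixed by all automorphisms are 0 and 1, an extended
-- submonoid is just a multiplicatively closed set containing 0 and 1.
--
-- * Complementation turns products into unions, so the union-closed
--   conjecture is equivalent to the monoidal form in all dimensions K ≥ 1
--   (a family is first restricted to the coordinates of its union).
-- * Given a half-vanishing coordinate j of M, keep the members with a 1 at j
--   and equally many members with a 0 at j having fewest ones; this is an
--   extended submonoid for which the ideal {x | xⱼ = 0} is covering.
-- * Conversely, a proper nonzero covering ideal I identifies R/I with F₂ᵏ,
--   k < N.  Lifting transpositions of classes of R/I injects the members of
--   M with a 1 at a coordinate into those with a 0, which reduces the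
--   monoidal form for M to that for the image of M̂ in F₂ᵏ; strong
--   induction on the dimension finishes the argument.

module Submission where

open import Defs

open import Data.Bool using (Bool; true; false; not; _∧_; _∨_; _xor_; T; T?; if_then_else_)
import Data.Bool.Properties as Boolₚ
open import Data.Nat using (ℕ; zero; suc; _+_; _*_; _≤_; _<_; z≤n; s≤s)
import Data.Nat.Properties as ℕₚ
open import Data.Nat.Induction using (<-rec)
open import Data.Fin using (Fin; zero; suc)
import Data.Fin.Properties as Finₚ
open import Data.Fin.Permutation using (Permutation; _⟨$⟩ʳ_; _⟨$⟩ˡ_; inverseʳ; inverseˡ; transpose)
open import Data.Fin.Subset using (⁅_⁆; ∁; _∪_; ∣_∣)
import Data.Fin.Subset.Properties as Subsetₚ
open import Data.Vec using (Vec; []; _∷_; lookup; tabulate; zipWith; replicate)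
import Data.Vec.Properties as Vecₚ
open import Data.Product using (∃; _×_; _,_; proj₁; proj₂)
open import Data.Sum using (_⊎_; inj₁; inj₂; [_,_]′)
import Data.Sum as Sum

open import Data.List using (List; []; _∷_; length; map; _++_; filterᵇ; take)
import Data.List as List
import Data.List.Properties as Listₚ
open import Data.List.Membership.Propositional using (_∈_; _∉_)
open import Data.List.Membership.Propositional.Properties
  using (∈-lookup; ∈-filter⁺; ∈-filter⁻; ∈-map⁺; ∈-map⁻; ∈-++⁺ˡ; ∈-++⁺ʳ; ∈-length; ∈-allFin)
import Data.List.Membership.DecPropositional
open import Data.List.Relation.Unary.Any using (here; there; index)
import Data.List.Relation.Unary.Any as Any
open import Data.List.Relation.Unary.Any.Properties using (lookup-index)
import Data.List.Relation.Unary.All as All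
open import Data.List.Relation.Unary.All.Properties using (All¬⇒¬Any)
open import Data.List.Relation.Unary.AllPairs using (AllPairs)
open import Data.List.Relation.Unary.Unique.Propositional using (Unique; []; _∷_)
import Data.List.Relation.Unary.Unique.Propositional.Properties as Uniqueₚ
open import Data.List.Relation.Binary.Disjoint.Propositional using (Disjoint)
open import Data.List.Relation.Binary.Permutation.Propositional using (↭-sym; ↭⇒↭ₛ′)
open import Data.List.Relation.Binary.Permutation.Propositional.Properties using (∈-resp-↭; ↭-length)
import Data.List.Relation.Binary.Permutation.Setoid.Properties as PermutationSetoid
import Data.List.Sort
open import Data.List.Relation.Unary.Sorted.TotalOrder.Properties using (Sorted⇒AllPairs)

open import Function using (_∘_; Injective)
open import Function.Bundles using (Equivalence; Inverse; Injection; mk↔ₛ′; _⇔_; mk⇔)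
open import Function.Construct.Identity using (↔-id)
open import Function.Properties.Inverse using (Inverse⇒Injection)
open import Relation.Nullary using (¬_; Dec; yes; no; does; contradiction)
open import Relation.Nullary.Decidable using (dec-true; decidable-stable)
open import Relation.Binary.Bundles using (DecTotalOrder)
open import Relation.Binary.Definitions using (DecidableEquality)
open import Relation.Binary.Structures using (IsEquivalence)
import Relation.Binary.Construct.On as On
open import Relation.Binary.PropositionalEquality
  using (_≡_; _≢_; refl; sym; trans; cong; cong₂; subst; subst₂; module ≡-Reasoning; setoid; isEquivalence)

module _ {A : Set} where

  lookup-injective : ∀ {xs : List A} → Unique xs →
                     ∀ {i j} → List.lookup xs i ≡ List.lookup xs j → i ≡ j
  lookup-injective (_ ∷ _) {zero} {zero} _ = refl
  lookup-injective (x∉ ∷ _) {zero} {suc j} e = contradiction e (All.lookup x∉ (∈-lookup j))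
  lookup-injective (x∉ ∷ _) {suc i} {zero} e = contradiction (sym e) (All.lookup x∉ (∈-lookup i))
  lookup-injective (_ ∷ u) {suc i} {suc j} e = cong suc (lookup-injective u e)

  length-≤-injection : ∀ {B : Set} {xs : List A} {ys : List B} (f : A → B) → Unique xs →
                       (∀ {x} → x ∈ xs → f x ∈ ys) →
                       (∀ {x y} → x ∈ xs → y ∈ xs → f x ≡ f y → x ≡ y) →
                       length xs ≤ length ys
  length-≤-injection {xs = xs} {ys} f u into inj = Finₚ.injective⇒≤ position-injective
    where
    position : Fin (length xs) → Fin (length ys)
    position i = index (into (∈-lookup i))

    position-injective : Injective _≡_ _≡_ position
    position-injective {i} {j} e = lookup-injective u (inj (∈-lookup i) (∈-lookup j) (begin
      f (List.lookup xs i)        ≡⟨ lookup-index (into (∈-lookup i)) ⟩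
      List.lookup ys (position i) ≡⟨ cong (List.lookup ys) e ⟩
      List.lookup ys (position j) ≡⟨ lookup-index (into (∈-lookup j)) ⟨
      f (List.lookup xs j)        ∎))
      where open ≡-Reasoning

  ∈-filterᵇ⁺ : ∀ (p : A → Bool) {xs x} → x ∈ xs → p x ≡ true → x ∈ filterᵇ p xs
  ∈-filterᵇ⁺ p x∈ px = ∈-filter⁺ (T? ∘ p) x∈ (Equivalence.from Boolₚ.T-≡ px)

  ∈-filterᵇ⁻ : ∀ (p : A → Bool) {xs x} → x ∈ filterᵇ p xs → x ∈ xs × p x ≡ true
  ∈-filterᵇ⁻ p x∈ = let (x∈xs , px) = ∈-filter⁻ (T? ∘ p) x∈
                      in x∈xs , Equivalence.to Boolₚ.T-≡ px

  length-filterᵇ-split : ∀ (p q : A → Bool) xs →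
    length (filterᵇ (λ x → p x ∧ q x) xs) + length (filterᵇ (λ x → p x ∧ not (q x)) xs)
      ≡ length (filterᵇ p xs)
  length-filterᵇ-split p q [] = refl
  length-filterᵇ-split p q (x ∷ xs) with p x | q x
  ... | false | _     = length-filterᵇ-split p q xs
  ... | true  | true  = cong suc (length-filterᵇ-split p q xs)
  ... | true  | false = trans (ℕₚ.+-suc _ _) (cong suc (length-filterᵇ-split p q xs))

  filterᵇ-true : ∀ (xs : List A) → filterᵇ (λ _ → true) xs ≡ xs
  filterᵇ-true []       = refl
  filterᵇ-true (x ∷ xs) = cong (x ∷_) (filterᵇ-true xs)

  some-member : ∀ {xs : List A} → 0 < length xs → ∃ (_∈ xs)
  some-member {x ∷ _} _ = x , here refl

  ∈-take : ∀ k {xs : List A} {x} → x ∈ take k xs → x ∈ xs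
  ∈-take (suc k) {_ ∷ _} (here e) = here e
  ∈-take (suc k) {_ ∷ _} (there x∈) = there (∈-take k x∈)

module Exchange {A : Set} (_≟_ : DecidableEquality A) where

  exchange : List A → List A → A → A
  exchange (a ∷ as) (b ∷ bs) x with x ≟ a | x ≟ b
  ... | yes _ | _     = b
  ... | no _  | yes _ = a
  ... | no _  | no _  = exchange as bs x
  exchange _ _ x = x

  private
    exchange-headˡ : ∀ a b as bs → exchange (a ∷ as) (b ∷ bs) a ≡ b
    exchange-headˡ a b as bs with a ≟ a
    ... | yes _  = refl
    ... | no a≢a = contradiction refl a≢a

    exchange-headʳ : ∀ {a b} as bs → a ≢ b → exchange (a ∷ as) (b ∷ bs) b ≡ a
    exchange-headʳ {a} {b} as bs a≢b with b ≟ a | b ≟ b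
    ... | yes b≡a | _     = contradiction (sym b≡a) a≢b
    ... | no _    | yes _ = refl
    ... | no _    | no b≢b = contradiction refl b≢b

    exchange-tail : ∀ {a b x} as bs → x ≢ a → x ≢ b →
                    exchange (a ∷ as) (b ∷ bs) x ≡ exchange as bs x
    exchange-tail {a} {b} {x} as bs x≢a x≢b with x ≟ a | x ≟ b
    ... | yes x≡a | _       = contradiction x≡a x≢a
    ... | no _    | yes x≡b = contradiction x≡b x≢b
    ... | no _    | no _    = refl

  exchange-fixes : ∀ as bs {y} → y ∉ as → y ∉ bs → exchange as bs y ≡ y
  exchange-fixes (a ∷ as) (b ∷ bs) {y} y∉as y∉bs =
    trans (exchange-tail as bs (y∉as ∘ here) (y∉bs ∘ here))
          (exchange-fixes as bs (y∉as ∘ there) (y∉bs ∘ there))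
  exchange-fixes []       _        _ _ = refl
  exchange-fixes (_ ∷ _)  []       _ _ = refl

  exchange-∈ˡ : ∀ {as bs x} → length as ≡ length bs → Disjoint as bs →
                x ∈ as → exchange as bs x ∈ bs
  exchange-∈ˡ {a ∷ as} {b ∷ bs} {x} len disj x∈ with x ≟ a | x ≟ b
  ... | yes _ | _       = here refl
  ... | no _  | yes x≡b = contradiction (x∈ , here x≡b) disj
  ... | no x≢a | no _   with x∈
  ...   | here x≡a = contradiction x≡a x≢a
  ...   | there x∈as = there (exchange-∈ˡ (ℕₚ.suc-injective len)
                                  (λ (p , q) → disj (there p , there q)) x∈as)

  exchange-∈ʳ : ∀ {as bs x} → length as ≡ length bs → Disjoint as bs →
                x ∈ bs → exchange as bs x ∈ as
  exchange-∈ʳ {a ∷ as} {b ∷ bs} {x} len disj x∈ with x ≟ a | x ≟ b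
  ... | yes x≡a | _     = contradiction (here x≡a , x∈) disj
  ... | no _    | yes _ = here refl
  ... | no _    | no x≢b with x∈
  ...   | here x≡b = contradiction x≡b x≢b
  ...   | there x∈bs = there (exchange-∈ʳ (ℕₚ.suc-injective len)
                                  (λ (p , q) → disj (there p , there q)) x∈bs)

  exchange-involutive : ∀ {as bs} → Unique as → Unique bs → Disjoint as bs →
                        ∀ x → exchange as bs (exchange as bs x) ≡ x
  exchange-involutive {a ∷ as} {b ∷ bs} (a∉as ∷ ua) (b∉bs ∷ ub) disj x = by-cases (x ≟ a) (x ≟ b)
    where
    open ≡-Reasoning
    e = exchange (a ∷ as) (b ∷ bs)
    y = exchange as bs x
    involutive = exchange-involutive ua ub (λ (p , q) → disj (there p , there q))
    a≢b : a ≢ b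
    a≢b a≡b = disj (here refl , here a≡b)
    -- a point outside both tails is fixed, so y = c would force x = c
    avoids : ∀ {c} → c ∉ as → c ∉ bs → x ≢ c → y ≢ c
    avoids {c} c∉as c∉bs x≢c y≡c = x≢c (begin
      x                    ≡⟨ involutive x ⟨
      exchange as bs y     ≡⟨ cong (exchange as bs) y≡c ⟩
      exchange as bs c     ≡⟨ exchange-fixes as bs c∉as c∉bs ⟩
      c                    ∎)
    by-cases : Dec (x ≡ a) → Dec (x ≡ b) → e (e x) ≡ x
    by-cases (yes refl) _ = trans (cong e (exchange-headˡ a b as bs)) (exchange-headʳ as bs a≢b)
    by-cases (no _) (yes refl) = trans (cong e (exchange-headʳ as bs a≢b)) (exchange-headˡ a b as bs)
    by-cases (no x≢a) (no x≢b) = begin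
      e (e x)            ≡⟨ cong e (exchange-tail as bs x≢a x≢b) ⟩
      e y                ≡⟨ exchange-tail as bs (avoids (All¬⇒¬Any a∉as) (λ a∈ → disj (here refl , there a∈)) x≢a)
                                                (avoids (λ b∈ → disj (there b∈ , here refl)) (All¬⇒¬Any b∉bs) x≢b) ⟩
      exchange as bs y   ≡⟨ involutive x ⟩
      x                  ∎
  exchange-involutive {[]}    _ _ _ _ = refl
  exchange-involutive {_ ∷ _} {[]} _ _ _ _ = refl

  module Pairing {as cs : List A} (as-unique : Unique as) (cs-unique : Unique cs)
                 (disjoint : Disjoint as cs) (shorter : length as ≤ length cs) where

    bs : List A
    bs = take (length as) cs

    bs⊆cs : ∀ {x} → x ∈ bs → x ∈ cs
    bs⊆cs = ∈-take (length as)

    length-bs : length as ≡ length bs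
    length-bs = sym (trans (Listₚ.length-take (length as) cs) (ℕₚ.m≤n⇒m⊓n≡m shorter))

    bs-unique : Unique bs
    bs-unique = Uniqueₚ.take⁺ (length as) cs-unique

    as-bs-disjoint : Disjoint as bs
    as-bs-disjoint (x∈as , x∈bs) = disjoint (x∈as , bs⊆cs x∈bs)

    pair : A → A
    pair = exchange as bs

    pair-involutive : ∀ x → pair (pair x) ≡ x
    pair-involutive = exchange-involutive as-unique bs-unique as-bs-disjoint

    pair-injective : ∀ {x y} → pair x ≡ pair y → x ≡ y
    pair-injective {x} {y} eq = trans (sym (pair-involutive x)) (trans (cong pair eq) (pair-involutive y))

    pair-∈ˡ : ∀ {x} → x ∈ as → pair x ∈ bs
    pair-∈ˡ = exchange-∈ˡ length-bs as-bs-disjoint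

    pair-∈ʳ : ∀ {x} → x ∈ bs → pair x ∈ as
    pair-∈ʳ = exchange-∈ʳ length-bs as-bs-disjoint

module Preimage {A B : Set} (_≟_ : DecidableEquality B) (f : A → B) (default : A) where

  preimage : List A → B → A
  preimage [] y = default
  preimage (x ∷ xs) y with f x ≟ y
  ... | yes _ = x
  ... | no _  = preimage xs y

  preimage-maps : ∀ {xs y} → y ∈ map f xs → f (preimage xs y) ≡ y
  preimage-maps {x ∷ xs} {y} y∈ with f x ≟ y
  ... | yes fx≡y = fx≡y
  ... | no fx≢y with y∈
  ...   | here y≡fx = contradiction (sym y≡fx) fx≢y
  ...   | there y∈′ = preimage-maps y∈′

  preimage-satisfies : ∀ (P : A → Set) → P default → ∀ {xs} → (∀ {x} → x ∈ xs → P x) → ∀ y → P (preimage xs y)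
  preimage-satisfies P P-default {[]}     _   y = P-default
  preimage-satisfies P P-default {x ∷ xs} all y with f x ≟ y
  ... | yes _ = all (here refl)
  ... | no _  = preimage-satisfies P P-default (all ∘ there) y

module SortedPrefix {A : Set} (key : A → ℕ) where

  private
    keyOrder : DecTotalOrder _ _ _
    keyOrder = On.decTotalOrder ℕₚ.≤-decTotalOrder key

  open Data.List.Sort keyOrder using (sort-↭; sort-↗)
  open Data.List.Sort keyOrder public using (sort)

  sort-∈⁺ : ∀ {xs x} → x ∈ xs → x ∈ sort xs
  sort-∈⁺ {xs} = ∈-resp-↭ (↭-sym (sort-↭ xs))

  sort-∈⁻ : ∀ {xs x} → x ∈ sort xs → x ∈ xs
  sort-∈⁻ {xs} = ∈-resp-↭ (sort-↭ xs)

  sort-unique : ∀ {xs} → Unique xs → Unique (sort xs)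
  sort-unique {xs} = PermutationSetoid.Unique-resp-↭ (setoid A)
                       (↭⇒↭ₛ′ isEquivalence (↭-sym (sort-↭ xs)))

  sort-length : ∀ xs → length (sort xs) ≡ length xs
  sort-length xs = ↭-length (sort-↭ xs)

  sort-sorted : ∀ xs → AllPairs (λ a b → key a ≤ key b) (sort xs)
  sort-sorted xs = Sorted⇒AllPairs (DecTotalOrder.totalOrder keyOrder) (sort-↗ xs)

  take-downward : ∀ k {xs b y} → AllPairs (λ a b → key a ≤ key b) xs →
                  b ∈ take k xs → y ∈ xs → key y < key b → y ∈ take k xs
  take-downward (suc k) {_ ∷ _} (_ ∷ _) (here refl) (here refl) lt = contradiction lt (ℕₚ.<-irrefl refl)
  take-downward (suc k) {_ ∷ _} (x≤ ∷ _) (here refl) (there y∈) lt =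
    contradiction (All.lookup x≤ y∈) (ℕₚ.<⇒≱ lt)
  take-downward (suc k) {_ ∷ _} _ (there _) (here refl) _ = here refl
  take-downward (suc k) {_ ∷ _} (_ ∷ s) (there b∈) (there y∈) lt = there (take-downward k s b∈ y∈ lt)

∧-true : ∀ {a b} → a ∧ b ≡ true → a ≡ true × b ≡ true
∧-true {true} {true} _ = refl , refl

∨-true : ∀ {a b} → a ∨ b ≡ true → a ≡ true ⊎ b ≡ true
∨-true {true}  _ = inj₁ refl
∨-true {false} b = inj₂ b

not-true : ∀ {a} → not a ≡ true → a ≡ false
not-true {false} _ = refl

if-id : ∀ b → (if b then true else false) ≡ b
if-id true  = refl
if-id false = refl

if-not : ∀ b → (if b then false else true) ≡ not b
if-not true  = refl
if-not false = refl

⇔-≡ : ∀ {a b} → (a ≡ true → b ≡ true) → (b ≡ true → a ≡ true) → a ≡ b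
⇔-≡ {false} {false} _ _ = refl
⇔-≡ {false} {true}  _ b⇒a = b⇒a refl
⇔-≡ {true}  {_}     a⇒b _ = sym (a⇒b refl)

xor-≡-false : ∀ {a b} → a xor b ≡ false → a ≡ b
xor-≡-false {false} {false} _ = refl
xor-≡-false {true}  {true}  _ = refl

≡⇒xor-≡-false : ∀ {a b} → a ≡ b → a xor b ≡ false
≡⇒xor-≡-false {a} refl = Boolₚ.xor-same a

≢⇒xor-≡-true : ∀ {a b} → a ≢ b → a xor b ≡ true
≢⇒xor-≡-true {false} {false} a≢b = contradiction refl a≢b
≢⇒xor-≡-true {false} {true}  _   = refl
≢⇒xor-≡-true {true}  {false} _   = refl
≢⇒xor-≡-true {true}  {true}  a≢b = contradiction refl a≢b

-- R n = Vec Bool n is also `Subset n`: multiplication is intersection,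
-- 1ᴿ is the full and 0ᴿ the empty subset, so the lemmas of
-- Data.Fin.Subset.Properties apply to it.

module _ {n : ℕ} where

  ext : {x y : R n} → (∀ i → lookup x i ≡ lookup y i) → x ≡ y
  ext {x} {y} same = begin
    x                      ≡⟨ Vecₚ.tabulate∘lookup x ⟨
    tabulate (lookup x)    ≡⟨ Vecₚ.tabulate-cong same ⟩
    tabulate (lookup y)    ≡⟨ Vecₚ.tabulate∘lookup y ⟩
    y                      ∎
    where open ≡-Reasoning

  lookup-+ : ∀ (x y : R n) i → lookup (x +ᴿ y) i ≡ lookup x i xor lookup y i
  lookup-+ x y i = Vecₚ.lookup-zipWith _xor_ i x y

  lookup-* : ∀ (x y : R n) i → lookup (x *ᴿ y) i ≡ lookup x i ∧ lookup y i
  lookup-* x y i = Vecₚ.lookup-zipWith _∧_ i x y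

  lookup-0 : ∀ i → lookup (0ᴿ {n}) i ≡ false
  lookup-0 i = Vecₚ.lookup-replicate i false

  lookup-1 : ∀ i → lookup (1ᴿ {n}) i ≡ true
  lookup-1 i = Vecₚ.lookup-replicate i true

  +-assoc : ∀ (x y z : R n) → (x +ᴿ y) +ᴿ z ≡ x +ᴿ (y +ᴿ z)
  +-assoc = Vecₚ.zipWith-assoc Boolₚ.xor-assoc

  +-comm : ∀ (x y : R n) → x +ᴿ y ≡ y +ᴿ x
  +-comm = Vecₚ.zipWith-comm Boolₚ.xor-comm

  +-self : ∀ (x : R n) → x +ᴿ x ≡ 0ᴿ
  +-self x = ext λ i → trans (lookup-+ x x i) (trans (Boolₚ.xor-same (lookup x i)) (sym (lookup-0 i)))

  +-identityˡ : ∀ (x : R n) → 0ᴿ +ᴿ x ≡ x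
  +-identityˡ = Vecₚ.zipWith-identityˡ Boolₚ.xor-identityˡ

  +-cancelʳ : ∀ (x y : R n) → (x +ᴿ y) +ᴿ y ≡ x
  +-cancelʳ x y = begin
    (x +ᴿ y) +ᴿ y  ≡⟨ +-assoc x y y ⟩
    x +ᴿ (y +ᴿ y)  ≡⟨ cong (x +ᴿ_) (+-self y) ⟩
    x +ᴿ 0ᴿ        ≡⟨ Vecₚ.zipWith-identityʳ Boolₚ.xor-identityʳ x ⟩
    x              ∎
    where open ≡-Reasoning

  +-cancelˡ : ∀ (x y : R n) → x +ᴿ (x +ᴿ y) ≡ y
  +-cancelˡ x y = begin
    x +ᴿ (x +ᴿ y)  ≡⟨ cong (x +ᴿ_) (+-comm x y) ⟩
    x +ᴿ (y +ᴿ x)  ≡⟨ +-comm x (y +ᴿ x) ⟩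
    (y +ᴿ x) +ᴿ x  ≡⟨ +-cancelʳ y x ⟩
    y              ∎
    where open ≡-Reasoning

  +-translate : ∀ (x y z : R n) → (x +ᴿ z) +ᴿ (y +ᴿ z) ≡ x +ᴿ y
  +-translate x y z = begin
    (x +ᴿ z) +ᴿ (y +ᴿ z)  ≡⟨ +-assoc x z (y +ᴿ z) ⟩
    x +ᴿ (z +ᴿ (y +ᴿ z))  ≡⟨ cong (λ v → x +ᴿ (z +ᴿ v)) (+-comm y z) ⟩
    x +ᴿ (z +ᴿ (z +ᴿ y))  ≡⟨ cong (x +ᴿ_) (+-cancelˡ z y) ⟩
    x +ᴿ y                ∎
    where open ≡-Reasoning

  nonzero⇒one : ∀ {x : R n} → x ≢ 0ᴿ → ∃ λ i → lookup x i ≡ true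
  nonzero⇒one {x} x≢0 with Finₚ.any? (λ i → lookup x i Boolₚ.≟ true)
  ... | yes one = one
  ... | no none = contradiction (ext λ i → trans (Boolₚ.¬-not (λ xi → none (i , xi))) (sym (lookup-0 i))) x≢0

elements : ∀ n → List (R n)
elements zero    = [] ∷ []
elements (suc n) = map (false ∷_) (elements n) ++ map (true ∷_) (elements n)

∈-elements : ∀ {n} (x : R n) → x ∈ elements n
∈-elements [] = here refl
∈-elements {suc n} (false ∷ x) = ∈-++⁺ˡ (∈-map⁺ (false ∷_) (∈-elements x))
∈-elements {suc n} (true ∷ x)  = ∈-++⁺ʳ (map (false ∷_) (elements n)) (∈-map⁺ (true ∷_) (∈-elements x))

elements-unique : ∀ n → Unique (elements n)
elements-unique zero    = All.[] ∷ []
elements-unique (suc n) =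
  Uniqueₚ.++⁺ (Uniqueₚ.map⁺ Vecₚ.∷-injectiveʳ (elements-unique n))
              (Uniqueₚ.map⁺ Vecₚ.∷-injectiveʳ (elements-unique n))
              different-heads
  where
  different-heads : Disjoint (map (false ∷_) (elements n)) (map (true ∷_) (elements n))
  different-heads (x∈ , y∈) with ∈-map⁻ (false ∷_) x∈ | ∈-map⁻ (true ∷_) y∈
  ... | _ , _ , refl | _ , _ , ()

module _ {n : ℕ} where

  members : SubsetR n → List (R n)
  members P = filterᵇ P (elements n)

  #_ : SubsetR n → ℕ
  # P = length (members P)

  ∈-members⁺ : ∀ P {x} → P x ≡ true → x ∈ members P
  ∈-members⁺ P {x} Px = ∈-filterᵇ⁺ P (∈-elements x) Px

  ∈-members⁻ : ∀ P {x} → x ∈ members P → P x ≡ true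
  ∈-members⁻ P x∈ = proj₂ (∈-filterᵇ⁻ P {elements n} x∈)

  members-unique : ∀ P → Unique (members P)
  members-unique P = Uniqueₚ.filter⁺ (T? ∘ P) (elements-unique n)

  #-injection : ∀ {P Q : SubsetR n} (f : R n → R n) →
                (∀ {x} → P x ≡ true → Q (f x) ≡ true) →
                (∀ {x y} → P x ≡ true → P y ≡ true → f x ≡ f y → x ≡ y) →
                # P ≤ # Q
  #-injection {P} {Q} f into inj =
    length-≤-injection f (members-unique P)
      (λ x∈ → ∈-members⁺ Q (into (∈-members⁻ P x∈)))
      (λ x∈ y∈ → inj (∈-members⁻ P x∈) (∈-members⁻ P y∈))

  #-split : ∀ (P Q : SubsetR n) → # (λ x → P x ∧ Q x) + # (λ x → P x ∧ not (Q x)) ≡ # P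
  #-split P Q = length-filterᵇ-split P Q (elements n)

  open Data.List.Membership.DecPropositional (Vecₚ.≡-dec {n = n} Boolₚ._≟_) using (_∈?_)

  listed : List (R n) → SubsetR n
  listed xs x = does (x ∈? xs)

  listed⁺ : ∀ {xs x} → x ∈ xs → listed xs x ≡ true
  listed⁺ {xs} {x} = dec-true (x ∈? xs)

  listed⁻ : ∀ {xs x} → listed xs x ≡ true → x ∈ xs
  listed⁻ {xs} {x} _ with x ∈? xs
  ... | yes x∈ = x∈

pullback : ∀ {m n} → (Fin m → Fin n) → R n → R m
pullback τ x = tabulate (lookup x ∘ τ)

module _ {m n : ℕ} (τ : Fin m → Fin n) where

  lookup-pullback : ∀ (x : R n) k → lookup (pullback τ x) k ≡ lookup x (τ k)
  lookup-pullback x k = Vecₚ.lookup∘tabulate (lookup x ∘ τ) k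

  pullback-zipWith : ∀ (f : Bool → Bool → Bool) (x y : R n) →
                     pullback τ (zipWith f x y) ≡ zipWith f (pullback τ x) (pullback τ y)
  pullback-zipWith f x y = ext λ k → begin
    lookup (pullback τ (zipWith f x y)) k          ≡⟨ lookup-pullback (zipWith f x y) k ⟩
    lookup (zipWith f x y) (τ k)                   ≡⟨ Vecₚ.lookup-zipWith f (τ k) x y ⟩
    f (lookup x (τ k)) (lookup y (τ k))            ≡⟨ cong₂ f (lookup-pullback x k) (lookup-pullback y k) ⟨
    f (lookup (pullback τ x) k) (lookup (pullback τ y) k) ≡⟨ Vecₚ.lookup-zipWith f k (pullback τ x) (pullback τ y) ⟨
    lookup (zipWith f (pullback τ x) (pullback τ y)) k ∎
    where open ≡-Reasoning

  pullback-replicate : ∀ b → pullback τ (replicate n b) ≡ replicate m b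
  pullback-replicate b = ext λ k →
    trans (lookup-pullback (replicate n b) k)
          (trans (Vecₚ.lookup-replicate (τ k) b) (sym (Vecₚ.lookup-replicate k b)))

module _ {n : ℕ} where

  permute : Permutation n n → Automorphism n
  permute π = record
    { bij   = mk↔ₛ′ (pullback (π ⟨$⟩ʳ_)) (pullback (π ⟨$⟩ˡ_))
                (cancel (π ⟨$⟩ʳ_) (π ⟨$⟩ˡ_) (λ _ → inverseˡ π))
                (cancel (π ⟨$⟩ˡ_) (π ⟨$⟩ʳ_) (λ _ → inverseʳ π))
    ; hom-+ = pullback-zipWith (π ⟨$⟩ʳ_) _xor_
    ; hom-* = pullback-zipWith (π ⟨$⟩ʳ_) _∧_
    ; hom-1 = pullback-replicate (π ⟨$⟩ʳ_) true
    }
    where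
    cancel : ∀ (σ τ : Fin n → Fin n) → (∀ k → τ (σ k) ≡ k) → ∀ x → pullback σ (pullback τ x) ≡ x
    cancel σ τ τσ x = ext λ k → trans (lookup-pullback σ (pullback τ x) k)
                                  (trans (lookup-pullback τ x (σ k)) (cong (lookup x) (τσ k)))

  -- an element fixed by all automorphisms has all coordinates equal,
  -- as the transposition of i and j fixes it
  fixed⇒constant : ∀ {x : R n} → FixedByAut x → ∀ i j → lookup x i ≡ lookup x j
  fixed⇒constant {x} fixed i j = begin
    lookup x i                           ≡⟨ cong (λ z → lookup z i) (fixed (permute (transpose i j))) ⟨
    lookup (pullback (τ ⟨$⟩ʳ_) x) i       ≡⟨ lookup-pullback (τ ⟨$⟩ʳ_) x i ⟩
    lookup x (τ ⟨$⟩ʳ i)                  ≡⟨ cong (lookup x) transpose-sends ⟩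
    lookup x j                           ∎
    where
    open ≡-Reasoning
    τ = transpose i j
    transpose-sends : τ ⟨$⟩ʳ i ≡ j
    transpose-sends rewrite dec-true (i Finₚ.≟ i) refl = refl

  fixed⇒0or1 : ∀ {x : R n} → FixedByAut x → x ≡ 0ᴿ ⊎ x ≡ 1ᴿ
  fixed⇒0or1 {[]} _ = inj₁ refl
  fixed⇒0or1 {false ∷ x} fixed = inj₁ (ext λ i → trans (fixed⇒constant fixed i zero) (sym (lookup-0 i)))
  fixed⇒0or1 {true ∷ x}  fixed = inj₂ (ext λ i → trans (fixed⇒constant fixed i zero) (sym (lookup-1 i)))

  fixed-0 : FixedByAut (0ᴿ {n})
  fixed-0 σ = begin
    to 0ᴿ                ≡⟨ cong to (+-self 0ᴿ) ⟨
    to (0ᴿ +ᴿ 0ᴿ)        ≡⟨ hom-+ 0ᴿ 0ᴿ ⟩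
    to 0ᴿ +ᴿ to 0ᴿ       ≡⟨ +-self (to 0ᴿ) ⟩
    0ᴿ                   ∎
    where
    open ≡-Reasoning
    open Automorphism σ

  extendedSubmonoid : ∀ {M : SubsetR n} → 1ᴿ ∈ᴿ M → 0ᴿ ∈ᴿ M →
                      (∀ {x y} → x ∈ᴿ M → y ∈ᴿ M → (x *ᴿ y) ∈ᴿ M) → IsExtendedSubmonoid M
  extendedSubmonoid {M} 1∈ 0∈ closed = record
    { one∈ = 1∈ ; *-closed = closed
    ; fixed⊆ = λ fixed → [ (λ x≡0 → subst (_∈ᴿ M) (sym x≡0) 0∈) , (λ x≡1 → subst (_∈ᴿ M) (sym x≡1) 1∈) ]′
                            (fixed⇒0or1 fixed) }

  0∈ : ∀ {M : SubsetR n} → IsExtendedSubmonoid M → 0ᴿ ∈ᴿ M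
  0∈ hM = IsExtendedSubmonoid.fixed⊆ hM fixed-0

-- Under complementation x ↦ ∁ x, multiplication becomes union, so the
-- conjecture turns into a statement about extended submonoids M of F₂ᴷ:
-- some coordinate vanishes on at least half of the members of M.

module _ {n : ℕ} where

  Ones Zeros : SubsetR n → Fin n → SubsetR n
  Ones  M j x = M x ∧ lookup x j
  Zeros M j x = M x ∧ not (lookup x j)

  ∈Ones⁻ : ∀ M j {x} → Ones M j x ≡ true → x ∈ᴿ M × lookup x j ≡ true
  ∈Ones⁻ M j {x} = ∧-true {M x} {lookup x j}

  ∈Zeros⁻ : ∀ M j {x} → Zeros M j x ≡ true → x ∈ᴿ M × lookup x j ≡ false
  ∈Zeros⁻ M j {x} one = let (Mx , ¬xj) = ∧-true {M x} {not (lookup x j)} one in Mx , not-true ¬xj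

  HalfVanishing : SubsetR n → Fin n → Set
  HalfVanishing M j = # (Ones M j) ≤ # (Zeros M j)

MonoidalConjecture : ℕ → Set
MonoidalConjecture K = (M : SubsetR K) → IsExtendedSubmonoid M → ∃ (HalfVanishing M)

-- Forgetting the coordinates outside W ⊆ Fin N identifies the vectors
-- supported on W with F₂ᵏ, k = |W|.
module Restriction {N : ℕ} (W : Fin N → Bool) where

  coordinates : List (Fin N)
  coordinates = filterᵇ W (List.allFin N)

  k : ℕ
  k = length coordinates

  ι : Fin k → Fin N
  ι = List.lookup coordinates

  ι-∈W : ∀ a → W (ι a) ≡ true
  ι-∈W a = proj₂ (∈-filterᵇ⁻ W {List.allFin N} (∈-lookup a))

  ι-onto : ∀ {i} → W i ≡ true → ∃ λ a → ι a ≡ i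
  ι-onto {i} Wi = let i∈ = ∈-filterᵇ⁺ W (∈-allFin i) Wi in index i∈ , sym (lookup-index i∈)

  restrict : R N → R k
  restrict = pullback ι

  restrict-≡⇒agree : ∀ {x y} → restrict x ≡ restrict y → ∀ {i} → W i ≡ true → lookup x i ≡ lookup y i
  restrict-≡⇒agree {x} {y} eq Wi with ι-onto Wi
  ... | a , refl = begin
    lookup x (ι a)         ≡⟨ lookup-pullback ι x a ⟨
    lookup (restrict x) a  ≡⟨ cong (λ z → lookup z a) eq ⟩
    lookup (restrict y) a  ≡⟨ lookup-pullback ι y a ⟩
    lookup y (ι a)         ∎
    where open ≡-Reasoning

  agree⇒restrict-≡ : ∀ {x y} → (∀ {i} → W i ≡ true → lookup x i ≡ lookup y i) → restrict x ≡ restrict y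
  agree⇒restrict-≡ {x} {y} agree = ext λ a →
    trans (lookup-pullback ι x a) (trans (agree (ι-∈W a)) (sym (lookup-pullback ι y a)))

  k-positive : ∀ {i} → W i ≡ true → 0 < k
  k-positive {i} Wi = ∈-length (∈-filterᵇ⁺ W (∈-allFin i) Wi)

  k<N : ∀ {i} → W i ≡ false → k < N
  k<N {i} ¬Wi = subst (k <_) (Listₚ.length-tabulate (λ a → a))
    (Listₚ.filter-notAll (T? ∘ W) (List.allFin N)
      (Any.map (λ { refl T-Wi → subst T ¬Wi T-Wi }) (∈-allFin i)))

∑ : ∀ {m n} → (Fin m → R n) → R n
∑ {zero}  f = 0ᴿ
∑ {suc m} f = f zero +ᴿ ∑ (f ∘ suc)

∑-∷ : ∀ {m n} (f : Fin m → R n) → ∑ (λ i → false ∷ f i) ≡ false ∷ ∑ f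
∑-∷ {zero}  f = refl
∑-∷ {suc m} f = cong ((false ∷ f zero) +ᴿ_) (∑-∷ (f ∘ suc))

decompose : ∀ {n} (x : R n) → ∑ (λ i → x *ᴿ ⁅ i ⁆) ≡ x
decompose-tail : ∀ {n} (x : R n) → (x *ᴿ 0ᴿ) +ᴿ ∑ (λ i → x *ᴿ ⁅ i ⁆) ≡ x
decompose [] = refl
decompose (true ∷ x)  = trans (cong (λ v → (true ∷ x *ᴿ 0ᴿ) +ᴿ v) (∑-∷ (λ i → x *ᴿ ⁅ i ⁆)))
                              (cong (true ∷_) (decompose-tail x))
decompose (false ∷ x) = trans (cong (λ v → (false ∷ x *ᴿ 0ᴿ) +ᴿ v) (∑-∷ (λ i → x *ᴿ ⁅ i ⁆)))
                              (cong (false ∷_) (decompose-tail x))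

decompose-tail x = begin
  (x *ᴿ 0ᴿ) +ᴿ ∑ (λ i → x *ᴿ ⁅ i ⁆)  ≡⟨ cong (λ v → v +ᴿ ∑ (λ i → x *ᴿ ⁅ i ⁆)) (Subsetₚ.∩-zeroʳ x) ⟩
  0ᴿ +ᴿ ∑ (λ i → x *ᴿ ⁅ i ⁆)         ≡⟨ +-identityˡ _ ⟩
  ∑ (λ i → x *ᴿ ⁅ i ⁆)               ≡⟨ decompose x ⟩
  x                                  ∎
  where open ≡-Reasoning

⁅⁆-absorbs : ∀ {n} {x : R n} {i} → lookup x i ≡ true → ⁅ i ⁆ *ᴿ x ≡ ⁅ i ⁆
⁅⁆-absorbs {x = true ∷ x} {zero}  refl = cong (true ∷_) (Subsetₚ.∩-zeroˡ x)
⁅⁆-absorbs {x = _ ∷ x}    {suc i} xi   = cong (false ∷_) (⁅⁆-absorbs xi)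

*⁅⁆-vanishes : ∀ {n} {x : R n} {i} → lookup x i ≡ false → x *ᴿ ⁅ i ⁆ ≡ 0ᴿ
*⁅⁆-vanishes {x = false ∷ x} {zero}  refl = cong (false ∷_) (Subsetₚ.∩-zeroʳ x)
*⁅⁆-vanishes {x = b ∷ x}     {suc i} xi   = cong₂ _∷_ (Boolₚ.∧-zeroʳ b) (*⁅⁆-vanishes xi)

module IdealStructure {n : ℕ} (I : Ideal n) where

  private
    P = proj₁ I
    open IsIdeal (proj₂ I)

  basis∈ : ∀ {x i} → x ∈ᴿ P → lookup x i ≡ true → ⁅ i ⁆ ∈ᴿ P
  basis∈ {i = i} x∈ xi = subst (_∈ᴿ P) (⁅⁆-absorbs xi) (*-closed ⁅ i ⁆ x∈)

  ∑-closed : ∀ {m} {f : Fin m → R n} → (∀ i → f i ∈ᴿ P) → ∑ f ∈ᴿ P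
  ∑-closed {zero}  _   = zero∈
  ∑-closed {suc m} f∈ = +-closed (f∈ zero) (∑-closed (f∈ ∘ suc))

  ∈-from-basis : ∀ {x} → (∀ i → lookup x i ≡ true → ⁅ i ⁆ ∈ᴿ P) → x ∈ᴿ P
  ∈-from-basis {x} basis = subst (_∈ᴿ P) (decompose x) (∑-closed component∈)
    where
    component∈ : ∀ i → (x *ᴿ ⁅ i ⁆) ∈ᴿ P
    component∈ i with lookup x i in xi
    ... | true  = *-closed x (basis i xi)
    ... | false = subst (_∈ᴿ P) (sym (*⁅⁆-vanishes xi)) zero∈

  free : Fin n → Bool
  free i = not (P ⁅ i ⁆)

  ~⇒agree : ∀ {x y} → _~_ I x y → ∀ {i} → free i ≡ true → lookup x i ≡ lookup y i
  ~⇒agree {x} {y} x~y {i} free-i with lookup x i Boolₚ.≟ lookup y i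
  ... | yes same = same
  ... | no differ = contradiction (trans (sym free-i) (cong not ⁅i⁆∈)) λ ()
    where ⁅i⁆∈ = basis∈ x~y (trans (lookup-+ x y i) (≢⇒xor-≡-true differ))

  agree⇒~ : ∀ {x y} → (∀ {i} → free i ≡ true → lookup x i ≡ lookup y i) → _~_ I x y
  agree⇒~ {x} {y} agree = ∈-from-basis basis
    where
    basis : ∀ i → lookup (x +ᴿ y) i ≡ true → ⁅ i ⁆ ∈ᴿ P
    basis i differ with P ⁅ i ⁆ in ⁅i⁆∈
    ... | true  = refl
    ... | false = contradiction (trans (sym differ) (trans (lookup-+ x y i) (≡⇒xor-≡-false (agree (cong not ⁅i⁆∈))))) λ ()

  proper⇒free : ProperIdeal I → ∃ λ i → free i ≡ true
  proper⇒free (x , x∉) with Finₚ.any? (λ i → free i Boolₚ.≟ true)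
  ... | yes found = found
  ... | no none = contradiction (trans (sym x∈) x∉) λ ()
    where x∈ = ∈-from-basis (λ i _ → Boolₚ.not-injective (Boolₚ.¬-not (λ free-i → none (i , free-i))))

  nonzero⇒killed : NonzeroIdeal I → ∃ λ i → free i ≡ false
  nonzero⇒killed (x , x∈ , x≢0) = let (i , xi) = nonzero⇒one x≢0 in i , cong not (basis∈ x∈ xi)

∁-involutive : ∀ {n} (x : R n) → ∁ (∁ x) ≡ x
∁-involutive []      = refl
∁-involutive (a ∷ x) = cong₂ _∷_ (Boolₚ.not-involutive a) (∁-involutive x)

∁-injective : ∀ {n} {x y : R n} → ∁ x ≡ ∁ y → x ≡ y
∁-injective {x = x} {y} eq = trans (sym (∁-involutive x)) (trans (cong ∁ eq) (∁-involutive y))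

∁-* : ∀ {n} (x y : R n) → ∁ (x *ᴿ y) ≡ ∁ x ∪ ∁ y
∁-* []          []      = refl
∁-* (true ∷ x)  (b ∷ y) = cong (not b ∷_) (∁-* x y)
∁-* (false ∷ x) (b ∷ y) = cong (true ∷_) (∁-* x y)

lookup-∁ : ∀ {n} (x : R n) i → lookup (∁ x) i ≡ not (lookup x i)
lookup-∁ x i = Vecₚ.lookup-map i not x

count∋-filterᵇ : ∀ {m} i (S : List (R m)) → count∋ i S ≡ length (filterᵇ (λ C → lookup C i) S)
count∋-filterᵇ i S = cong length (Listₚ.filter-≐ (i Subsetₚ.∈?_) (T? ∘ (λ C → lookup C i))
  ( (λ i∈C → Equivalence.from Boolₚ.T-≡ (Vecₚ.[]=⇒lookup i∈C))
  , (λ {C} T-Ci → Vecₚ.lookup⇒[]= i C (Equivalence.to Boolₚ.T-≡ T-Ci)) ) S)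

complements : ∀ {n} → List (R n) → SubsetR n
complements T y = listed T (∁ y)

complements-submonoid : ∀ {n} {T : List (R n)} → UnionClosed T → 0ᴿ ∈ T → 1ᴿ ∈ T →
                        IsExtendedSubmonoid (complements T)
complements-submonoid {n} {T} closed 0∈T 1∈T = extendedSubmonoid
  (listed⁺ (subst (_∈ T) (sym ∁-1) 0∈T))
  (listed⁺ (subst (_∈ T) (sym ∁-0) 1∈T))
  (λ {x} {y} x∈ y∈ → listed⁺ (subst (_∈ T) (sym (∁-* x y)) (closed (listed⁻ x∈) (listed⁻ y∈))))
  where
  ∁-0 : ∁ (0ᴿ {n}) ≡ 1ᴿ
  ∁-0 = ext λ i → trans (lookup-∁ 0ᴿ i) (trans (cong not (lookup-0 i)) (sym (lookup-1 i)))
  ∁-1 : ∁ (1ᴿ {n}) ≡ 0ᴿ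
  ∁-1 = trans (cong ∁ (sym ∁-0)) (∁-involutive 0ᴿ)

module ComplementFamily {n : ℕ} (M : SubsetR (suc n)) (hM : IsExtendedSubmonoid M) where

  family : List (R (suc n))
  family = map ∁ (members M)

  unique : Unique family
  unique = Uniqueₚ.map⁺ ∁-injective (members-unique M)

  union-closed : UnionClosed family
  union-closed C∈ D∈ with ∈-map⁻ ∁ C∈ | ∈-map⁻ ∁ D∈
  ... | x , x∈ , refl | y , y∈ , refl =
    subst (_∈ family) (∁-* x y)
      (∈-map⁺ ∁ (∈-members⁺ M (IsExtendedSubmonoid.*-closed hM (∈-members⁻ M x∈) (∈-members⁻ M y∈))))

  length-family : length family ≡ # M
  length-family = Listₚ.length-map ∁ (members M)

  -- 0 and 1 are different members
  two-members : 1 < length family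
  two-members = subst (1 <_) (sym length-family)
    (length-≤-injection {xs = 0ᴿ ∷ 1ᴿ ∷ []} (λ x → x) (((λ ()) All.∷ All.[]) ∷ All.[] ∷ [])
      (λ { (here refl) → ∈-members⁺ M (0∈ hM) ; (there (here refl)) → ∈-members⁺ M (IsExtendedSubmonoid.one∈ hM) })
      (λ _ _ e → e))

half-bound : ∀ {a b c} → a + b ≤ 2 * c → c ≤ b → a ≤ b
half-bound {a} {b} {c} sum≤ c≤b = ℕₚ.+-cancelʳ-≤ b a b (ℕₚ.≤-trans sum≤ (begin
  2 * c    ≤⟨ ℕₚ.*-monoʳ-≤ 2 c≤b ⟩
  2 * b    ≡⟨ cong (b +_) (ℕₚ.+-identityʳ b) ⟩
  b + b    ∎))
  where open ℕₚ.≤-Reasoning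

-- The union-closed conjecture implies its monoidal form: apply it to the
-- complements of the members of M; the sets containing j are the
-- complements of the members vanishing at j.
uc⇒monoidal : UnionClosedConjecture → ∀ n → MonoidalConjecture (suc n)
uc⇒monoidal uc n M hM = j , half-bound size≤ containing≤zeros
  where
  open ComplementFamily M hM
  found = uc (suc n) family unique two-members union-closed
  j = proj₁ found

  size≤ : # (Ones M j) + # (Zeros M j) ≤ 2 * count∋ j family
  size≤ = subst (_≤ 2 * count∋ j family) (trans length-family (sym (#-split M (λ x → lookup x j))))
                (proj₂ found)

  complement-vanishes : ∀ {C} → C ∈ filterᵇ (λ C → lookup C j) family → ∁ C ∈ members (Zeros M j)
  complement-vanishes C∈ with ∈-filterᵇ⁻ (λ C → lookup C j) C∈
  ... | C∈family , Cj with ∈-map⁻ ∁ C∈family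
  ...   | x , x∈ , refl = subst (_∈ members (Zeros M j)) (sym (∁-involutive x))
                            (∈-members⁺ (Zeros M j) (cong₂ _∧_ (∈-members⁻ M x∈) (trans (sym (lookup-∁ x j)) Cj)))

  containing≤zeros : count∋ j family ≤ # (Zeros M j)
  containing≤zeros = subst (_≤ # (Zeros M j)) (sym (count∋-filterᵇ j family))
    (length-≤-injection ∁ (Uniqueₚ.filter⁺ (T? ∘ (λ C → lookup C j)) unique)
                          complement-vanishes (λ _ _ → ∁-injective))

⋃⁺ : ∀ {m} → R m → List (R m) → R m
⋃⁺ A []       = A
⋃⁺ A (B ∷ Bs) = A ∪ ⋃⁺ B Bs

lookup-∪ : ∀ {m} (x y : R m) i → lookup (x ∪ y) i ≡ lookup x i ∨ lookup y i
lookup-∪ x y i = Vecₚ.lookup-zipWith _∨_ i x y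

⋃⁺∈ : ∀ {m} {S : List (R m)} → UnionClosed S → ∀ {A Bs} → A ∈ S → (∀ {B} → B ∈ Bs → B ∈ S) → ⋃⁺ A Bs ∈ S
⋃⁺∈ closed {Bs = []}     A∈ Bs⊆ = A∈
⋃⁺∈ closed {Bs = B ∷ Bs} A∈ Bs⊆ = closed A∈ (⋃⁺∈ closed (Bs⊆ (here refl)) (Bs⊆ ∘ there))

⋃⁺-upper : ∀ {m} {A C : R m} {Bs i} → C ∈ A ∷ Bs → lookup C i ≡ true → lookup (⋃⁺ A Bs) i ≡ true
⋃⁺-upper {A = A} {Bs = []}     (here refl) Ci = Ci
⋃⁺-upper {A = A} {Bs = B ∷ Bs} {i} (here refl) Ci =
  trans (lookup-∪ A (⋃⁺ B Bs) i) (cong (_∨ lookup (⋃⁺ B Bs) i) Ci)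
⋃⁺-upper {A = A} {Bs = B ∷ Bs} {i} (there C∈) Ci =
  trans (lookup-∪ A (⋃⁺ B Bs) i) (trans (cong (lookup A i ∨_) (⋃⁺-upper C∈ Ci)) (Boolₚ.∨-zeroʳ (lookup A i)))

-- Restricting the
-- family S to the coordinates of its union U and adding ∅ yields a
-- union-closed family S′ in F₂ᵏ containing ∅ and the full set, whose
-- complements form an extended submonoid M; a coordinate vanishing on half
-- of M lies in at least half of the members of S.
module MonoidalToUnionClosed (monoidal : ∀ {k} → 0 < k → MonoidalConjecture k)
  {m : ℕ} (A B : R m) (rest : List (R m))
  (S-unique : Unique (A ∷ B ∷ rest)) (closed : UnionClosed (A ∷ B ∷ rest)) where

  S : List (R m)
  S = A ∷ B ∷ rest

  A≢B : A ≢ B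
  A≢B A≡B = Uniqueₚ.Unique[x∷xs]⇒x∉xs S-unique (here A≡B)

  U : R m
  U = ⋃⁺ A (B ∷ rest)

  open Restriction (lookup U)

  U∈S : U ∈ S
  U∈S = ⋃⁺∈ closed (here refl) there

  ⊆U : ∀ {C i} → C ∈ S → lookup C i ≡ true → lookup U i ≡ true
  ⊆U = ⋃⁺-upper

  restrict-injective : ∀ {C D} → C ∈ S → D ∈ S → restrict C ≡ restrict D → C ≡ D
  restrict-injective {C} {D} C∈ D∈ eq = ext agree
    where
    agree : ∀ i → lookup C i ≡ lookup D i
    agree i with lookup U i in Ui
    ... | true = restrict-≡⇒agree {C} {D} eq Ui
    ... | false with lookup C i in Ci | lookup D i in Di
    ...   | false | false = refl
    ...   | true  | _     = contradiction (trans (sym (⊆U C∈ Ci)) Ui) λ ()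
    ...   | false | true  = contradiction (trans (sym (⊆U D∈ Di)) Ui) λ ()

  S′ : List (R k)
  S′ = 0ᴿ ∷ map restrict S

  S′-closed : UnionClosed S′
  S′-closed {X} {Y} X∈ Y∈ with X∈ | Y∈
  ... | here refl | _         = subst (_∈ S′) (sym (Subsetₚ.∪-identityˡ Y)) Y∈
  ... | there _   | here refl = subst (_∈ S′) (sym (Subsetₚ.∪-identityʳ X)) X∈
  ... | there X∈′ | there Y∈′ with ∈-map⁻ restrict X∈′ | ∈-map⁻ restrict Y∈′
  ...   | C , C∈ , refl | D , D∈ , refl =
    there (subst (_∈ map restrict S) (pullback-zipWith ι _∨_ C D) (∈-map⁺ restrict (closed C∈ D∈)))

  1∈S′ : 1ᴿ ∈ S′
  1∈S′ = there (subst (_∈ map restrict S)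
                     (ext λ a → trans (lookup-pullback ι U a) (trans (ι-∈W a) (sym (lookup-1 a))))
                     (∈-map⁺ restrict U∈S))

  -- A and B differ, so one of them is nonempty and U has a coordinate
  some-coordinate : ∃ λ i → lookup U i ≡ true
  some-coordinate with Vecₚ.≡-dec Boolₚ._≟_ A 0ᴿ
  ... | no A≢0 = let (i , Ai) = nonzero⇒one A≢0 in i , ⊆U (here refl) Ai
  ... | yes A≡0 = let (i , Bi) = nonzero⇒one (λ B≡0 → A≢B (trans A≡0 (sym B≡0)))
                  in i , ⊆U (there (here refl)) Bi

  M : SubsetR k
  M = complements S′

  found : ∃ (HalfVanishing M)
  found = monoidal (k-positive (proj₂ some-coordinate)) M (complements-submonoid S′-closed (here refl) 1∈S′)

  a : Fin k
  a = proj₁ found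

  i : Fin m
  i = ι a

  contains lacks : R m → Bool
  contains C = lookup C i
  lacks    C = not (lookup C i)

  S₁ S₀ : List (R m)
  S₁ = filterᵇ contains S
  S₀ = filterᵇ lacks S

  avoiding≤ones : length S₀ ≤ # (Ones M a)
  avoiding≤ones = length-≤-injection (∁ ∘ restrict) (Uniqueₚ.filter⁺ (T? ∘ lacks) S-unique) into
    (λ C∈ D∈ eq → restrict-injective (proj₁ (∈-filterᵇ⁻ lacks {S} C∈)) (proj₁ (∈-filterᵇ⁻ lacks {S} D∈))
                                     (∁-injective eq))
    where
    into : ∀ {C} → C ∈ S₀ → ∁ (restrict C) ∈ members (Ones M a)
    into {C} C∈ = let (C∈S , ¬Ci) = ∈-filterᵇ⁻ lacks {S} C∈ in
      ∈-members⁺ (Ones M a) (cong₂ _∧_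
        (listed⁺ (subst (_∈ S′) (sym (∁-involutive (restrict C))) (there (∈-map⁺ restrict C∈S))))
        (trans (lookup-∁ (restrict C) a) (trans (cong not (lookup-pullback ι C a)) ¬Ci)))

  zeros≤containing : # (Zeros M a) ≤ length S₁
  zeros≤containing = subst (# (Zeros M a) ≤_) (Listₚ.length-map restrict S₁)
    (length-≤-injection ∁ (members-unique (Zeros M a)) into (λ _ _ → ∁-injective))
    where
    into : ∀ {y} → y ∈ members (Zeros M a) → ∁ y ∈ map restrict S₁
    into {y} y∈ = from-S′ (listed⁻ {xs = S′} (proj₁ zero-at-a))
      where
      zero-at-a = ∈Zeros⁻ M a {y} (∈-members⁻ (Zeros M a) y∈)

      ∁y-at-a : lookup (∁ y) a ≡ true
      ∁y-at-a = trans (lookup-∁ y a) (cong not (proj₂ zero-at-a))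

      from-S′ : ∁ y ∈ S′ → ∁ y ∈ map restrict S₁
      from-S′ (here ∁y≡0) =
        contradiction (trans (sym ∁y-at-a) (trans (cong (λ z → lookup z a) ∁y≡0) (lookup-0 a))) λ ()
      from-S′ (there ∁y∈) =
        let (C , C∈S , ∁y≡) = ∈-map⁻ restrict {xs = S} ∁y∈
            Ci : lookup C i ≡ true
            Ci = trans (sym (lookup-pullback ι C a)) (trans (cong (λ z → lookup z a) (sym ∁y≡)) ∁y-at-a)
        in subst (_∈ map restrict S₁) (sym ∁y≡) (∈-map⁺ restrict (∈-filterᵇ⁺ contains C∈S Ci))

  S-splits : length S₁ + length S₀ ≡ length S
  S-splits = trans (length-filterᵇ-split (λ _ → true) contains S) (cong length (filterᵇ-true S))

  half-of-S : length S ≤ 2 * count∋ i S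
  half-of-S = begin
    length S                  ≡⟨ S-splits ⟨
    length S₁ + length S₀     ≤⟨ ℕₚ.+-monoʳ-≤ (length S₁) (ℕₚ.≤-trans avoiding≤ones (ℕₚ.≤-trans (proj₂ found) zeros≤containing)) ⟩
    length S₁ + length S₁     ≡⟨ cong (length S₁ +_) (ℕₚ.+-identityʳ (length S₁)) ⟨
    2 * length S₁             ≡⟨ cong (2 *_) (count∋-filterᵇ i S) ⟨
    2 * count∋ i S            ∎
    where open ℕₚ.≤-Reasoning

monoidal⇒uc : (∀ n → MonoidalConjecture (suc n)) → UnionClosedConjecture
monoidal⇒uc monoidal m []            _      ()           _
monoidal⇒uc monoidal m (A ∷ [])      _      (s≤s ())     _
monoidal⇒uc monoidal m (A ∷ B ∷ rest) unique (s≤s (s≤s _)) closed = i , half-of-S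
  where
  positive : ∀ {k} → 0 < k → MonoidalConjecture k
  positive {suc k} _ = monoidal k
  open MonoidalToUnionClosed positive A B rest unique closed

module VanishingIdeal {n : ℕ} (j : Fin n) where

  vanishing : SubsetR n
  vanishing x = not (lookup x j)

  ideal : Ideal n
  ideal = vanishing , record
    { zero∈      = cong not (lookup-0 j)
    ; +-closed   = λ {x} {y} x∈ y∈ → cong not (trans (lookup-+ x y j) (cong₂ _xor_ (not-true x∈) (not-true y∈)))
    ; neg-closed = λ x∈ → x∈
    ; *-closed   = λ r {x} x∈ → cong not (trans (lookup-* r x j)
                                  (trans (cong (lookup r j ∧_) (not-true x∈)) (Boolₚ.∧-zeroʳ _)))
    }

  ~⇒same : ∀ {x y} → _~_ ideal x y → lookup x j ≡ lookup y j
  ~⇒same {x} {y} x~y = xor-≡-false (trans (sym (lookup-+ x y j)) (not-true x~y))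

  same⇒~ : ∀ {x y} → lookup x j ≡ lookup y j → _~_ ideal x y
  same⇒~ {x} {y} same = cong not (trans (lookup-+ x y j) (≡⇒xor-≡-false same))

  module _ (g : SymQ ideal) where
    open Inverse g

    private
      preserves-classes : ∀ {x y} → lookup x j ≡ lookup y j → lookup (to x) j ≡ lookup (to y) j
      preserves-classes {x} {y} same = ~⇒same {to x} {to y} (to-cong (same⇒~ {x} {y} same))

      separates-0-1 : lookup (to 0ᴿ) j ≢ lookup (to 1ᴿ) j
      separates-0-1 same = contradiction
        (trans (sym (lookup-0 j)) (trans (~⇒same {0ᴿ} {1ᴿ} (Injection.injective (Inverse⇒Injection g)
                                                                      (same⇒~ {to 0ᴿ} {to 1ᴿ} same)))
                                         (lookup-1 j)))
        λ ()

      by-class : ∀ x → lookup (to x) j ≡ (if lookup x j then lookup (to 1ᴿ) j else lookup (to 0ᴿ) j)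
      by-class x with lookup x j in xj
      ... | false = preserves-classes (trans xj (sym (lookup-0 j)))
      ... | true  = preserves-classes (trans xj (sym (lookup-1 j)))

    class-action : (∀ x → lookup (to x) j ≡ lookup x j) ⊎ (∀ x → lookup (to x) j ≡ not (lookup x j))
    class-action with lookup (to 0ᴿ) j in g0 | lookup (to 1ᴿ) j in g1
    ... | false | true  = inj₁ λ x → trans (by-class x) (trans (cong₂ (if lookup x j then_else_) g1 g0) (if-id (lookup x j)))
    ... | true  | false = inj₂ λ x → trans (by-class x) (trans (cong₂ (if lookup x j then_else_) g1 g0) (if-not (lookup x j)))
    ... | false | false = contradiction (trans g0 (sym g1)) separates-0-1
    ... | true  | true  = contradiction (trans g0 (sym g1)) separates-0-1

*-shrinks : ∀ {n} (x y : R n) → x *ᴿ y ≡ y ⊎ ∣ x *ᴿ y ∣ < ∣ y ∣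
*-shrinks x y with (x *ᴿ y) Subsetₚ.⊂? y
... | yes xy⊂y = inj₂ (Subsetₚ.p⊂q⇒∣p∣<∣q∣ xy⊂y)
... | no  xy⊄y = inj₁ (Subsetₚ.⊆-antisym (Subsetₚ.p∩q⊆q x y) λ {i} i∈y →
    decidable-stable (i Subsetₚ.∈? (x *ᴿ y)) λ i∉xy → xy⊄y (Subsetₚ.p∩q⊆q x y , i , i∈y , i∉xy))

-- Given a coordinate j vanishing on at least half of M, keep the members of
-- M where j is 1 together with equally many members where j vanishes, taken
-- with as few ones as possible.  What is kept is an extended submonoid M̂
-- on which exchanging the two halves flips the j-th coordinate, so every
-- permutation of the two classes of the vanishing ideal lifts to M̂.
module BalancedSubmonoid {N : ℕ} (M : SubsetR N) (hM : IsExtendedSubmonoid M)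
                         (j : Fin N) (half : HalfVanishing M j) where

  open IsExtendedSubmonoid hM
  open SortedPrefix (∣_∣ {n = N})
  open Exchange (Vecₚ.≡-dec {n = N} Boolₚ._≟_)
  open VanishingIdeal j

  As Zs : List (R N)
  As = members (Ones M j)
  Zs = sort (members (Zeros M j))

  As⊆ones : ∀ {x} → x ∈ As → x ∈ᴿ M × lookup x j ≡ true
  As⊆ones x∈ = ∈Ones⁻ M j (∈-members⁻ (Ones M j) x∈)

  ones⊆As : ∀ {x} → x ∈ᴿ M → lookup x j ≡ true → x ∈ As
  ones⊆As Mx xj = ∈-members⁺ (Ones M j) (cong₂ _∧_ Mx xj)

  Zs⊆zeros : ∀ {x} → x ∈ Zs → x ∈ᴿ M × lookup x j ≡ false
  Zs⊆zeros x∈ = ∈Zeros⁻ M j (∈-members⁻ (Zeros M j) (sort-∈⁻ x∈))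

  zeros⊆Zs : ∀ {x} → x ∈ᴿ M → lookup x j ≡ false → x ∈ Zs
  zeros⊆Zs Mx xj = sort-∈⁺ (∈-members⁺ (Zeros M j) (cong₂ _∧_ Mx (cong not xj)))

  -- pair the ones with the zeros having fewest ones; Bs are the zeros kept
  open Pairing (members-unique (Ones M j)) (sort-unique (members-unique (Zeros M j)))
               (λ (x∈As , x∈Zs) → contradiction (trans (sym (proj₂ (As⊆ones x∈As))) (proj₂ (Zs⊆zeros x∈Zs))) λ ())
               (subst (length As ≤_) (sym (sort-length (members (Zeros M j)))) half)
    renaming (bs to Bs)

  Bs⊆zeros : ∀ {x} → x ∈ Bs → x ∈ᴿ M × lookup x j ≡ false
  Bs⊆zeros x∈ = Zs⊆zeros (bs⊆cs x∈)

  M̂ : SubsetR N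
  M̂ x = Ones M j x ∨ listed Bs x

  -- sorting by the number of ones makes Bs absorb multiplication by M
  Bs-absorbs : ∀ {x y} → x ∈ᴿ M → y ∈ Bs → (x *ᴿ y) ∈ Bs
  Bs-absorbs {x} {y} Mx y∈ with *-shrinks x y
  ... | inj₁ xy≡y = subst (_∈ Bs) (sym xy≡y) y∈
  ... | inj₂ fewer = take-downward (length As) (sort-sorted (members (Zeros M j))) y∈ xy∈Zs fewer
    where
    xy∈Zs : (x *ᴿ y) ∈ Zs
    xy∈Zs = zeros⊆Zs (*-closed Mx (proj₁ (Bs⊆zeros y∈)))
      (trans (lookup-* x y j) (trans (cong (lookup x j ∧_) (proj₂ (Bs⊆zeros y∈))) (Boolₚ.∧-zeroʳ _)))

  1∈As : 1ᴿ ∈ As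
  1∈As = ones⊆As one∈ (lookup-1 j)

  0∈Bs : 0ᴿ ∈ Bs
  0∈Bs = let (b , b∈) = some-member (subst (0 <_) length-bs (∈-length 1∈As))
         in subst (_∈ Bs) (Subsetₚ.∩-zeroˡ b) (Bs-absorbs (0∈ hM) b∈)

  ∈M̂⁻ : ∀ {x} → x ∈ᴿ M̂ → x ∈ As ⊎ x ∈ Bs
  ∈M̂⁻ x∈ = Sum.map (∈-members⁺ (Ones M j)) listed⁻ (∨-true x∈)

  As⊆M̂ : ∀ {x} → x ∈ As → x ∈ᴿ M̂
  As⊆M̂ {x} x∈ = cong (_∨ listed Bs x) (∈-members⁻ (Ones M j) x∈)

  Bs⊆M̂ : ∀ {x} → x ∈ Bs → x ∈ᴿ M̂
  Bs⊆M̂ {x} x∈ = trans (cong (Ones M j x ∨_) (listed⁺ x∈)) (Boolₚ.∨-zeroʳ _)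

  M̂⊆M : ∀ {x} → x ∈ᴿ M̂ → x ∈ᴿ M
  M̂⊆M x∈ = [ proj₁ ∘ As⊆ones , proj₁ ∘ Bs⊆zeros ]′ (∈M̂⁻ x∈)

  M̂-submonoid : IsExtendedSubmonoid M̂
  M̂-submonoid = extendedSubmonoid (As⊆M̂ 1∈As) (Bs⊆M̂ 0∈Bs) closed
    where
    closed : ∀ {x y} → x ∈ᴿ M̂ → y ∈ᴿ M̂ → (x *ᴿ y) ∈ᴿ M̂
    closed {x} {y} x∈ y∈ with ∈M̂⁻ x∈ | ∈M̂⁻ y∈
    ... | _         | inj₂ y∈Bs = Bs⊆M̂ (Bs-absorbs (M̂⊆M x∈) y∈Bs)
    ... | inj₂ x∈Bs | inj₁ _    = Bs⊆M̂ (subst (_∈ Bs) (Subsetₚ.∩-comm y x) (Bs-absorbs (M̂⊆M y∈) x∈Bs))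
    ... | inj₁ x∈As | inj₁ y∈As =
      let (Mx , xj) = As⊆ones x∈As ; (My , yj) = As⊆ones y∈As
      in As⊆M̂ (ones⊆As (*-closed Mx My) (trans (lookup-* x y j) (cong₂ _∧_ xj yj)))

  left-out-vanish : ∀ x → x ∈ᴿ M → ¬ (x ∈ᴿ M̂) → x ∈ᴿ vanishing
  left-out-vanish x Mx x∉ with lookup x j Boolₚ.≟ true
  ... | yes xj  = contradiction (As⊆M̂ (ones⊆As Mx xj)) x∉
  ... | no ¬xj = cong not (Boolₚ.¬-not ¬xj)

  swap : SymR N
  swap = mk↔ₛ′ pair pair pair-involutive pair-involutive

  swap-flips : ∀ {x} → x ∈ᴿ M̂ → pair x ∈ᴿ M̂ × lookup (pair x) j ≡ not (lookup x j)
  swap-flips x∈ with ∈M̂⁻ x∈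
  ... | inj₁ x∈As = let y∈ = pair-∈ˡ x∈As
                    in Bs⊆M̂ y∈ , trans (proj₂ (Bs⊆zeros y∈)) (sym (cong not (proj₂ (As⊆ones x∈As))))
  ... | inj₂ x∈Bs = let y∈ = pair-∈ʳ x∈Bs
                    in As⊆M̂ y∈ , trans (proj₂ (As⊆ones y∈)) (sym (cong not (proj₂ (Bs⊆zeros x∈Bs))))

  swap-stays : ∀ {x} → x ∈ᴿ M̂ → pair x ∈ᴿ M̂
  swap-stays x∈ = proj₁ (swap-flips x∈)

  swap-flips-j : ∀ {x} → x ∈ᴿ M̂ → lookup (pair x) j ≡ not (lookup x j)
  swap-flips-j x∈ = proj₂ (swap-flips x∈)

  -- a permutation of the two classes lifts to the identity or to the swap
  covering : IsCoveringIdeal M ideal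
  covering = M̂ , M̂-submonoid , (λ _ → M̂⊆M) , left-out-vanish , lift
    where
    lift : (g : SymQ ideal) → StabilizesQ ideal g M̂ →
           ∃ λ (g̃ : SymR N) → StabilizesR g̃ M̂ × (∀ x → x ∈ᴿ M̂ → _~_ ideal (Inverse.to g̃ x) (Inverse.to g x))
    lift g _ with class-action g
    ... | inj₁ keeps = ↔-id (R N) , ((λ _ x∈ → x∈) , (λ y y∈ → y , y∈ , refl)) ,
                       (λ x _ → same⇒~ {x} {Inverse.to g x} (sym (keeps x)))
    ... | inj₂ flips = swap , ((λ _ → swap-stays) , (λ y y∈ → pair y , swap-stays y∈ , pair-involutive y)) ,
                       (λ x x∈ → same⇒~ {pair x} {Inverse.to g x} (trans (swap-flips-j x∈) (sym (flips x))))

nonzero-vanishing-at : ∀ {n} (j : Fin (suc (suc n))) → ∃ λ x → lookup x j ≡ false × x ≢ 0ᴿ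
nonzero-vanishing-at zero    = ⁅ suc zero ⁆ , refl , λ eq → contradiction (cong (λ z → lookup z (suc zero)) eq) λ ()
nonzero-vanishing-at (suc j) = ⁅ zero ⁆ , Vecₚ.lookup-replicate j false , λ eq → contradiction (cong (λ z → lookup z zero) eq) λ ()

monoidal⇒network : ∀ {n} → MonoidalConjecture (suc (suc n)) → SymIsMonoidalNetwork (suc (suc n))
monoidal⇒network monoidal M hM = ideal , proper , nonzero , covering
  where
  j = proj₁ (monoidal M hM)
  open VanishingIdeal j
  open BalancedSubmonoid M hM j (proj₂ (monoidal M hM))

  proper : ProperIdeal ideal
  proper = 1ᴿ , cong not (lookup-1 j)

  nonzero : NonzeroIdeal ideal
  nonzero = let (x , xj , x≢0) = nonzero-vanishing-at j in x , cong not xj , x≢0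

module ClassTransposition {N : ℕ} (I : Ideal N) (c₁ c₂ : R N) where

  private
    P = proj₁ I
    open IsIdeal (proj₂ I)
    module ~ = IsEquivalence (~-isEquivalence I)

  d : R N
  d = c₁ +ᴿ c₂

  moved : R N → Bool
  moved x = P (x +ᴿ c₁) ∨ P (x +ᴿ c₂)

  τ : R N → R N
  τ x = if moved x then x +ᴿ d else x

  τ-moved : ∀ {x} → moved x ≡ true → τ x ≡ x +ᴿ d
  τ-moved {x} m rewrite m = refl

  τ-fixed : ∀ {x} → moved x ≡ false → τ x ≡ x
  τ-fixed {x} m rewrite m = refl

  shift₁ : ∀ x → (x +ᴿ d) +ᴿ c₁ ≡ x +ᴿ c₂
  shift₁ x = begin
    (x +ᴿ (c₁ +ᴿ c₂)) +ᴿ c₁   ≡⟨ +-assoc x d c₁ ⟩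
    x +ᴿ ((c₁ +ᴿ c₂) +ᴿ c₁)   ≡⟨ cong (λ z → x +ᴿ (z +ᴿ c₁)) (+-comm c₁ c₂) ⟩
    x +ᴿ ((c₂ +ᴿ c₁) +ᴿ c₁)   ≡⟨ cong (x +ᴿ_) (+-cancelʳ c₂ c₁) ⟩
    x +ᴿ c₂                   ∎
    where open ≡-Reasoning

  shift₂ : ∀ x → (x +ᴿ d) +ᴿ c₂ ≡ x +ᴿ c₁
  shift₂ x = trans (+-assoc x d c₂) (cong (x +ᴿ_) (+-cancelʳ c₁ c₂))

  c₁↦c₂ : ∀ {x} → _~_ I x c₁ → _~_ I (τ x) c₂
  c₁↦c₂ {x} x~c₁ = subst (_∈ᴿ P) (sym (trans (cong (_+ᴿ c₂) (τ-moved (cong (_∨ P (x +ᴿ c₂)) x~c₁))) (shift₂ x))) x~c₁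

  c₂↦c₁ : ∀ {x} → _~_ I x c₂ → _~_ I (τ x) c₁
  c₂↦c₁ {x} x~c₂ = subst (_∈ᴿ P) (sym (trans (cong (_+ᴿ c₁) (τ-moved moved-x)) (shift₁ x))) x~c₂
    where moved-x = trans (cong (P (x +ᴿ c₁) ∨_) x~c₂) (Boolₚ.∨-zeroʳ _)

  moved-shift : ∀ x → moved (x +ᴿ d) ≡ moved x
  moved-shift x rewrite shift₁ x | shift₂ x = Boolₚ.∨-comm (P (x +ᴿ c₂)) (P (x +ᴿ c₁))

  moved-cong : ∀ {x y} → _~_ I x y → moved x ≡ moved y
  moved-cong {x} {y} x~y = cong₂ _∨_ (same-class c₁) (same-class c₂)
    where
    same-class : ∀ c → P (x +ᴿ c) ≡ P (y +ᴿ c)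
    same-class c = ⇔-≡ (λ x~c → ~.trans {y} {x} {c} (~.sym {x} {y} x~y) x~c) (λ y~c → ~.trans {x} {y} {c} x~y y~c)

  τ-involutive : ∀ x → τ (τ x) ≡ x
  τ-involutive x = by-cases (moved x) refl
    where
    by-cases : ∀ b → moved x ≡ b → τ (τ x) ≡ x
    by-cases true  m = trans (cong τ (τ-moved m)) (trans (τ-moved (trans (moved-shift x) m)) (+-cancelʳ x d))
    by-cases false m = trans (cong τ (τ-fixed m)) (τ-fixed m)

  τ-cong : ∀ {x y} → _~_ I x y → _~_ I (τ x) (τ y)
  τ-cong {x} {y} x~y = by-cases (moved x) refl
    where
    open ≡-Reasoning
    by-cases : ∀ b → moved x ≡ b → _~_ I (τ x) (τ y)
    by-cases true mx = subst (_∈ᴿ P) (sym (begin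
        τ x +ᴿ τ y             ≡⟨ cong₂ _+ᴿ_ (τ-moved mx) (τ-moved (trans (sym (moved-cong x~y)) mx)) ⟩
        (x +ᴿ d) +ᴿ (y +ᴿ d)   ≡⟨ +-translate x y d ⟩
        x +ᴿ y                 ∎)) x~y
    by-cases false mx = subst₂ (_~_ I) (sym (τ-fixed mx)) (sym (τ-fixed (trans (sym (moved-cong x~y)) mx))) x~y

  transposition : SymQ I
  transposition = record
    { to = τ ; from = τ ; to-cong = τ-cong ; from-cong = τ-cong
    ; inverse = undo , undo
    }
    where
    undo : ∀ {x y} → _~_ I y (τ x) → _~_ I (τ y) x
    undo {x} {y} y~τx = subst (_~_ I (τ y)) (τ-involutive x) (τ-cong y~τx)

  stabilizes : ∀ {S : SubsetR N} → c₁ ∈ᴿ S → c₂ ∈ᴿ S → StabilizesQ I transposition S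
  stabilizes {S} c₁∈ c₂∈ = maps-into , maps-onto
    where
    maps-into : ∀ x → x ∈ᴿ S → ∃ λ y → y ∈ᴿ S × _~_ I (τ x) y
    maps-into x x∈ with P (x +ᴿ c₁) Boolₚ.≟ true | P (x +ᴿ c₂) Boolₚ.≟ true
    ... | yes x~c₁ | _        = c₂ , c₂∈ , c₁↦c₂ x~c₁
    ... | no _     | yes x~c₂ = c₁ , c₁∈ , c₂↦c₁ x~c₂
    ... | no x≁c₁  | no x≁c₂  = x , x∈ , subst (λ z → _~_ I z x) (sym (τ-fixed unmoved)) (~.refl {x})
      where unmoved = cong₂ _∨_ (Boolₚ.¬-not x≁c₁) (Boolₚ.¬-not x≁c₂)

    maps-onto : ∀ y → y ∈ᴿ S → ∃ λ x → x ∈ᴿ S × _~_ I (τ x) y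
    maps-onto y y∈ = let (z , z∈ , τy~z) = maps-into y y∈ in
      z , z∈ , subst (_~_ I (τ z)) (τ-involutive y) (τ-cong (~.sym {τ y} {z} τy~z))

-- Pair the image classes where a coordinate a is 1 with
-- image classes where it vanishes; lifting the transposition of each pair
-- of classes injects the members of M with a 1 at a into those with a 0.
module Descent {N : ℕ} (M : SubsetR N) (I : Ideal N)
               (proper : ProperIdeal I) (nonzero : NonzeroIdeal I) (cover : IsCoveringIdeal M I) where

  open IdealStructure I
  open Restriction free public using (k)
  open Restriction free hiding (k)

  private
    module ~ = IsEquivalence (~-isEquivalence I)

  M̂ : SubsetR N
  M̂ = proj₁ cover

  M̂-submonoid : IsExtendedSubmonoid M̂
  M̂-submonoid = proj₁ (proj₂ cover)

  M̂⊆M : ∀ x → x ∈ᴿ M̂ → x ∈ᴿ M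
  M̂⊆M = proj₁ (proj₂ (proj₂ cover))

  left-out∈I : ∀ x → x ∈ᴿ M → ¬ (x ∈ᴿ M̂) → x ∈ᴿ proj₁ I
  left-out∈I = proj₁ (proj₂ (proj₂ (proj₂ cover)))

  lifts : (g : SymQ I) → StabilizesQ I g M̂ →
          ∃ λ (g̃ : SymR N) → StabilizesR g̃ M̂ × (∀ x → x ∈ᴿ M̂ → _~_ I (Inverse.to g̃ x) (Inverse.to g x))
  lifts = proj₂ (proj₂ (proj₂ (proj₂ cover)))

  dimension-positive : 0 < k
  dimension-positive = k-positive (proj₂ (proper⇒free proper))

  dimension-drops : k < N
  dimension-drops = k<N (proj₂ (nonzero⇒killed nonzero))

  ~⇒restrict-≡ : ∀ {x y} → _~_ I x y → restrict x ≡ restrict y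
  ~⇒restrict-≡ {x} {y} x~y = agree⇒restrict-≡ {x} {y} (~⇒agree {x} {y} x~y)

  restrict-≡⇒~ : ∀ {x y} → restrict x ≡ restrict y → _~_ I x y
  restrict-≡⇒~ {x} {y} eq = agree⇒~ {x} {y} (restrict-≡⇒agree {x} {y} eq)

  image : SubsetR k
  image = listed (map restrict (members M̂))

  image⁺ : ∀ {x} → x ∈ᴿ M̂ → restrict x ∈ᴿ image
  image⁺ x∈ = listed⁺ (∈-map⁺ restrict (∈-members⁺ M̂ x∈))

  image⁻ : ∀ {y} → y ∈ᴿ image → ∃ λ x → x ∈ᴿ M̂ × y ≡ restrict x
  image⁻ y∈ = let (x , x∈ , eq) = ∈-map⁻ restrict (listed⁻ {xs = map restrict (members M̂)} y∈) in x , ∈-members⁻ M̂ x∈ , eq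

  image-submonoid : IsExtendedSubmonoid image
  image-submonoid = extendedSubmonoid
    (subst (_∈ᴿ image) (pullback-replicate ι true) (image⁺ one∈))
    (subst (_∈ᴿ image) (pullback-replicate ι false) (image⁺ (0∈ M̂-submonoid)))
    closed
    where
    open IsExtendedSubmonoid M̂-submonoid
    closed : ∀ {y z} → y ∈ᴿ image → z ∈ᴿ image → (y *ᴿ z) ∈ᴿ image
    closed y∈ z∈ with image⁻ y∈ | image⁻ z∈
    ... | x , x∈ , refl | w , w∈ , refl = subst (_∈ᴿ image) (pullback-zipWith ι _∧_ x w) (image⁺ (*-closed x∈ w∈))

  open Preimage (Vecₚ.≡-dec {n = k} Boolₚ._≟_) restrict 0ᴿ

  rep : R k → R N
  rep = preimage (members M̂)

  rep∈M̂ : ∀ y → rep y ∈ᴿ M̂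
  rep∈M̂ = preimage-satisfies (_∈ᴿ M̂) (0∈ M̂-submonoid) (∈-members⁻ M̂)

  restrict-rep : ∀ {y} → y ∈ᴿ image → restrict (rep y) ≡ y
  restrict-rep y∈ = preimage-maps {members M̂} (listed⁻ {xs = map restrict (members M̂)} y∈)

  transfer : ∀ {c₁ c₂} → c₁ ∈ᴿ M̂ → c₂ ∈ᴿ M̂ →
             ∃ λ (h : R N → R N) → Injective _≡_ _≡_ h ×
               (∀ {x} → x ∈ᴿ M̂ → _~_ I x c₁ → h x ∈ᴿ M̂ × _~_ I (h x) c₂)
  transfer {c₁} {c₂} c₁∈ c₂∈ =
    let (g̃ , (into , _) , lifted) = lifts transposition (stabilizes c₁∈ c₂∈)
    in Inverse.to g̃ , Injection.injective (Inverse⇒Injection g̃) ,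
       λ {x} x∈ x~c₁ → into x x∈ , ~.trans {Inverse.to g̃ x} {τ x} {c₂} (lifted x x∈) (c₁↦c₂ x~c₁)
    where open ClassTransposition I c₁ c₂

  module _ (a : Fin k) (half : HalfVanishing image a) where

    j : Fin N
    j = ι a

    open Exchange (Vecₚ.≡-dec {n = k} Boolₚ._≟_)
    open Pairing (members-unique (Ones image a)) (members-unique (Zeros image a))
                 (λ (y∈ , y∈′) → contradiction (trans (sym (proj₂ (∈Ones⁻ image a (∈-members⁻ (Ones image a) y∈))))
                                                       (proj₂ (∈Zeros⁻ image a (∈-members⁻ (Zeros image a) y∈′))))
                                                λ ())
                 half

    h : R k → R N → R N
    h y = proj₁ (transfer (rep∈M̂ y) (rep∈M̂ (pair y)))

    F : R N → R N
    F x = h (restrict x) x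

    ones⊆M̂ : ∀ {x} → Ones M j x ≡ true → x ∈ᴿ M̂
    ones⊆M̂ {x} one with M̂ x Boolₚ.≟ true
    ... | yes x∈ = x∈
    ... | no x∉ = let (Mx , xj) = ∈Ones⁻ M j one in
      contradiction (trans (sym (ι-∈W a)) (cong not (basis∈ (left-out∈I x Mx x∉) xj))) λ ()

    F-spec : ∀ {x} → Ones M j x ≡ true → F x ∈ᴿ M̂ × restrict (F x) ≡ pair (restrict x) × pair (restrict x) ∈ bs
    F-spec {x} one = proj₁ moved , trans (~⇒restrict-≡ (proj₂ moved)) (restrict-rep partner∈image) , partner∈
      where
      x∈M̂ = ones⊆M̂ one
      y = restrict x
      y∈ : y ∈ members (Ones image a)
      y∈ = ∈-members⁺ (Ones image a) (cong₂ _∧_ (image⁺ x∈M̂) (trans (lookup-pullback ι x a) (proj₂ (∈Ones⁻ M j one))))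
      partner∈ = pair-∈ˡ y∈
      partner∈image = proj₁ (∈Zeros⁻ image a (∈-members⁻ (Zeros image a) (bs⊆cs partner∈)))
      x~rep : _~_ I x (rep y)
      x~rep = restrict-≡⇒~ (sym (restrict-rep (image⁺ x∈M̂)))
      moved = proj₂ (proj₂ (transfer (rep∈M̂ y) (rep∈M̂ (pair y)))) x∈M̂ x~rep

    F-zero : ∀ {x} → Ones M j x ≡ true → Zeros M j (F x) ≡ true
    F-zero {x} one = let (Fx∈M̂ , restrict-Fx , partner∈) = F-spec one in
      cong₂ _∧_ (M̂⊆M (F x) Fx∈M̂) (begin
        not (lookup (F x) j)               ≡⟨ cong not (lookup-pullback ι (F x) a) ⟨
        not (lookup (restrict (F x)) a)    ≡⟨ cong (λ z → not (lookup z a)) restrict-Fx ⟩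
        not (lookup (pair (restrict x)) a) ≡⟨ cong not (proj₂ (∈Zeros⁻ image a (∈-members⁻ (Zeros image a) (bs⊆cs partner∈)))) ⟩
        true                               ∎)
      where open ≡-Reasoning

    F-injective : ∀ {x x′} → Ones M j x ≡ true → Ones M j x′ ≡ true → F x ≡ F x′ → x ≡ x′
    F-injective {x} {x′} one one′ eq = proj₁ (proj₂ (transfer (rep∈M̂ y) (rep∈M̂ (pair y))))
                                         (trans eq (cong (λ z → h z x′) (sym same-class)))
      where
      y = restrict x
      same-class : restrict x ≡ restrict x′
      same-class = pair-injective (trans (sym (proj₁ (proj₂ (F-spec one))))
                                         (trans (cong restrict eq) (proj₁ (proj₂ (F-spec one′)))))

    half-vanishing : HalfVanishing M j
    half-vanishing = #-injection F F-zero F-injective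

-- in F₂ the only extended submonoid is {0, 1}, and its coordinate vanishes once
one-dimensional : (M : SubsetR 1) → IsExtendedSubmonoid M → HalfVanishing M zero
one-dimensional M hM rewrite 0∈ hM | IsExtendedSubmonoid.one∈ hM = ℕₚ.≤-refl

network⇒monoidal : (∀ n → 1 < n → SymIsMonoidalNetwork n) → ∀ n → MonoidalConjecture (suc n)
network⇒monoidal network n = <-rec (λ N → 0 < N → MonoidalConjecture N) step (suc n) (s≤s z≤n)
  where
  step : ∀ N → (∀ {K} → K < N → 0 < K → MonoidalConjecture K) → 0 < N → MonoidalConjecture N
  step 0 _ ()
  step 1 _ _ M hM = zero , one-dimensional M hM
  step (suc (suc n)) smaller _ M hM =
    let (I , proper , nonzero , cover) = network (suc (suc n)) (s≤s (s≤s z≤n)) M hM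
        open Descent M I proper nonzero cover
        (a , half) = smaller dimension-drops dimension-positive image image-submonoid
    in j a half , half-vanishing a half

uc⇒network : UnionClosedConjecture → ∀ n → 1 < n → SymIsMonoidalNetwork n
uc⇒network uc (suc zero)    (s≤s ())
uc⇒network uc (suc (suc n)) _ = monoidal⇒network (uc⇒monoidal uc (suc n))

theorem1 : UnionClosedConjecture ⇔ (∀ (n : ℕ) → 1 < n → SymIsMonoidalNetwork n)
theorem1 = mk⇔ uc⇒network (λ network → monoidal⇒uc (network⇒monoidal network))
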